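{- Let $q$ be an odd prime power, $m_1,n_1,m_2,n_2\in\{1,\dots,q-1\}$, and suppose $D(q;m_1,n_1)\cong D(q;m_2,n_2)$. Then (i) $\gcd(m_1,q-1)=\gcd(m_2,q-1)$ and $\gcd(n_1,q-1)=\gcd(n_2,q-1)$; (ii) $\gcd(m_1+n_1,q-1)=\gcd(m_2+n_2,q-1)$; (iii) $\gcd(m_1-n_1,q-1)=\gcd(m_2-n_2,q-1)$. Moreover, these three conditions are independent: for each one of (i), (ii), (iii) there exist an odd prime power $q$ and parameters $m_1,n_1,m_2,n_2\in\{1,\dots,q-1\}$ satisfying the other two conditions but not that one.
   Context: $\mathbb{F}_q$ is the field with $q$ elements. For integers $1\le m,n\le q-1$, the monomial digraph $D(q;m,n)$ has vertex set $\mathbb{F}_q^2$, and $((x_1,x_2),(y_1,y_2))$ is an arc iff $x_2+y_2=x_1^m y_1^n$ (loops allowed). $\cong$ denotes digraph isomorphism. $\gcd(a,q-1)$ for an integer $a$ (possibly zero or negative) is the nonnegative greatest common divisor; in particular $\gcd(0,q-1)=q-1$. -}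

module Defs where

open import Level using (0ℓ)
open import Data.Nat as ℕ using (ℕ; zero; suc; _≤_; _∸_; _^_)
open import Data.Nat.Divisibility using (_∣_)
open import Data.Nat.Primality using (Prime)
open import Data.Integer as ℤ using (ℤ; +_)
open import Data.Integer.GCD as ℤG using ()
open import Data.Fin using (Fin)
open import Data.Product using (Σ; ∃; ∃₂; _×_; _,_)
open import Relation.Nullary using (¬_)
open import Relation.Binary.PropositionalEquality using (_≡_; _≢_)
open import Algebra.Structures using (IsCommutativeRing)
open import Function.Bundles using (_↔_; _⇔_; Inverse)

record FiniteField (q : ℕ) : Set₁ where
  infixl 6 _+_
  infixl 7 _*_
  field
    Carrier : Set
    _+_ _*_ : Carrier → Carrier → Carrier
    -_      : Carrier → Carrier
    0# 1#   : Carrier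
    isCommutativeRing : IsCommutativeRing _≡_ _+_ _*_ -_ 0# 1#
    0≢1     : 0# ≢ 1#
    inverse : ∀ x → x ≢ 0# → ∃ λ y → x * y ≡ 1#
    card    : Carrier ↔ Fin q

  _^ᶠ_ : Carrier → ℕ → Carrier
  x ^ᶠ zero  = 1#
  x ^ᶠ suc k = x * (x ^ᶠ k)

  Point : Set
  Point = Carrier × Carrier

  Arc : ℕ → ℕ → Point → Point → Set
  Arc m n (x₁ , x₂) (y₁ , y₂) = x₂ + y₂ ≡ (x₁ ^ᶠ m) * (y₁ ^ᶠ n)

DigraphIso : ∀ {q} (F : FiniteField q) → ℕ → ℕ → ℕ → ℕ → Set
DigraphIso F m₁ n₁ m₂ n₂ =
  Σ (Point ↔ Point) λ φ →
    ∀ u v → Arc m₁ n₁ u v ⇔ Arc m₂ n₂ (Inverse.to φ u) (Inverse.to φ v)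
  where open FiniteField F

OddPrimePower : ℕ → Set
OddPrimePower q =
  (∃₂ λ p k → Prime p × 1 ≤ k × q ≡ p ^ k) × ¬ (2 ∣ q)

InRange : ℕ → ℕ → Set
InRange q m = 1 ≤ m × m ≤ q ∸ 1

-- gcd(a, q-1) for an integer a (nonnegative gcd, gcd(0,q-1) = q-1)
gcdQ : ℕ → ℤ → ℤ
gcdQ q a = ℤG.gcd a (+ (q ∸ 1))

Cond-i : ℕ → ℕ → ℕ → ℕ → ℕ → Set
Cond-i q m₁ n₁ m₂ n₂ =
  gcdQ q (+ m₁) ≡ gcdQ q (+ m₂) × gcdQ q (+ n₁) ≡ gcdQ q (+ n₂)

Cond-ii : ℕ → ℕ → ℕ → ℕ → ℕ → Set
Cond-ii q m₁ n₁ m₂ n₂ =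
  gcdQ q (+ (m₁ ℕ.+ n₁)) ≡ gcdQ q (+ (m₂ ℕ.+ n₂))

Cond-iii : ℕ → ℕ → ℕ → ℕ → ℕ → Set
Cond-iii q m₁ n₁ m₂ n₂ =
  gcdQ q (+ m₁ ℤ.- + n₁) ≡ gcdQ q (+ m₂ ℤ.- + n₂)

Admissible : ℕ → ℕ → ℕ → ℕ → ℕ → Set
Admissible q m₁ n₁ m₂ n₂ =
  OddPrimePower q × InRange q m₁ × InRange q n₁ × InRange q m₂ × InRange q n₂

-- Each gcd is recovered from the isomorphism class of D(q;m,n) by counting vertices with a property
-- defined from the arc relation alone.  The counting rests on one fact about 𝔽_q^*: t^k = c has at
-- most gcd(k,q-1) solutions, and exactly that many for c = 1.
-- (i)   The out-twins of (1,0) (vertices with the same out-neighbourhood) are the (t,0) with t^m = 1,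
--       and no vertex has more out-twins; for n, reverse all arcs.
-- (iii) The 2-cycles through (x₁,x₂) correspond to the y with x₁^m y^n = y^m x₁^n: at least
--       1 + gcd(m-n,q-1) of them everywhere, and exactly that many through (1,0).
-- (ii)  For m ≠ n, a vertex whose out-neighbourhood is some in-neighbourhood lies on the axis x₁ = 0;
--       from such a vertex at most gcd(m+n,q-1) arcs lead to looped vertices, and from (0,-1/2),
--       which exists as q is odd, exactly that many.  For m = n, (iii) forces m₂ = n₂, and
--       gcd(2m,q-1) is a function of gcd(m,q-1).

module Submission where

open import Defs

open import Level using (0ℓ)
open import Algebra.Bundles using (CommutativeRing)
open import Algebra.Structures using (IsCommutativeRing; IsCommutativeMonoid)
import Algebra.Properties.Ring as RingProperties
import Algebra.Properties.Semiring.Mult as SemiringMultiplication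
open import Data.Empty using (⊥-elim)
open import Data.Fin as Fin using (Fin; punchIn)
import Data.Fin.Properties as Fin
open import Data.Integer as ℤ using (_⊖_)
import Data.Integer.Properties as ℤ
open import Data.List using (List; []; _∷_; map; length; foldr; tabulate; filter)
import Data.List.Properties as List
open import Data.List.Membership.Propositional using (_∈_)
import Data.List.Membership.Propositional.Properties as ∈
open import Data.List.Membership.Propositional.Properties.WithK using (unique∧set⇒bag)
open import Data.List.Relation.Binary.BagAndSetEquality using (∼bag⇒↭)
open import Data.List.Relation.Binary.Permutation.Propositional using (_↭_; ↭⇒↭ₛ)
import Data.List.Relation.Binary.Permutation.Setoid.Properties as Permutation
open import Data.List.Relation.Unary.All as All using (All; []; _∷_)
import Data.List.Relation.Unary.All.Properties as All
open import Data.List.Relation.Unary.AllPairs using ([]; _∷_)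
open import Data.List.Relation.Unary.Any using (here; there)
open import Data.List.Relation.Unary.Unique.Propositional using (Unique)
import Data.List.Relation.Unary.Unique.Propositional.Properties as Unique
open import Data.Nat as ℕ using (ℕ; zero; suc; _≤_; _<_; _≤?_; z≤n; s≤s; ∣_-_∣)
import Data.Nat.Properties as ℕ
open import Data.Nat.DivMod using (_%_; _/_; m≡m%n+[m/n]*n; m%n<n)
open import Data.Nat.Divisibility using (_∣_; _∣?_; divides; ∣-antisym; ∣-refl; n∣m*n; ∣⇒≤)
open import Data.Nat.GCD
  using ( gcd; gcd-GCD; module Bézout; gcd[m,n]∣m; gcd[m,n]∣n; gcd[m,n]≢0; gcd-greatest; gcd-assoc
        ; gcd-identityˡ; c*gcd[m,n]≡gcd[cm,cn])
open import Data.Nat.Primality using (prime?)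
open import Data.Product using (∃; ∃-syntax; _×_; _,_; proj₁; proj₂)
open import Data.Sum using (_⊎_; inj₁; inj₂)
open import Function using (_∘_)
open import Function.Bundles using (Inverse; _↔_; Equivalence; mk⇔)
open import Function.Definitions using (Injective)
open import Relation.Binary.Definitions using (DecidableEquality)
open import Relation.Binary.PropositionalEquality
open import Relation.Nullary using (¬_; yes; no; map′)
open import Relation.Nullary.Decidable using (True; toWitness; toWitnessFalse)
open import Relation.Unary using (_⊆_; _≐_; Decidable)
open import Relation.Unary.Properties using (∁?; ≐-sym; ≐-trans)

-- Counting by duplicate-free lists

AtLeast : {A : Set} → ℕ → (A → Set) → Set
AtLeast {A} k P = ∃[ xs ] Unique xs × All P xs × k ≤ length xs

AtMost : {A : Set} → ℕ → (A → Set) → Set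
AtMost {A} k P = (xs : List A) → Unique xs → All P xs → length xs ≤ k

module _ {A : Set} {P : A → Set} where

  AtLeast⇒≤AtMost : ∀ {k l} → AtLeast k P → AtMost l P → k ≤ l
  AtLeast⇒≤AtMost (xs , xs! , Pxs , k≤∣xs∣) bound = ℕ.≤-trans k≤∣xs∣ (bound xs xs! Pxs)

  AtLeast-⊆ : ∀ {k} {Q : A → Set} → P ⊆ Q → AtLeast k P → AtLeast k Q
  AtLeast-⊆ P⊆Q (xs , xs! , Pxs , k≤∣xs∣) = xs , xs! , All.map P⊆Q Pxs , k≤∣xs∣

  AtMost-⊆ : ∀ {k} {Q : A → Set} → P ⊆ Q → AtMost k Q → AtMost k P
  AtMost-⊆ P⊆Q bound xs xs! Pxs = bound xs xs! (All.map P⊆Q Pxs)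

  AtLeast-map : ∀ {B : Set} {k} {Q : B → Set} (f : A → B) → Injective _≡_ _≡_ f →
                P ⊆ Q ∘ f → AtLeast k P → AtLeast k Q
  AtLeast-map f f-inj P⊆Qf (xs , xs! , Pxs , k≤∣xs∣) =
    map f xs , Unique.map⁺ f-inj xs! , All.map⁺ (All.map P⊆Qf Pxs) ,
    ℕ.≤-trans k≤∣xs∣ (ℕ.≤-reflexive (sym (List.length-map f xs)))

  AtMost-graph : ∀ {B : Set} {k} (f : A → B) →
                 AtMost k P → AtMost k (λ v → P (proj₁ v) × proj₂ v ≡ f (proj₁ v))
  AtMost-graph f bound vs vs! Pvs = subst (_≤ _) (List.length-map proj₁ vs)
    (bound (map proj₁ vs) (proj₁-unique vs vs! (All.map proj₂ Pvs)) (All.map⁺ (All.map proj₁ Pvs)))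
    where
    proj₁-unique : ∀ vs → Unique vs → All (λ v → proj₂ v ≡ f (proj₁ v)) vs → Unique (map proj₁ vs)
    proj₁-unique []       []          []       = []
    proj₁-unique (v ∷ vs) (v∉ ∷ vs!) (e ∷ es) =
      All.map⁺ (All.zipWith distinct (v∉ , es)) ∷ proj₁-unique vs vs! es
      where
      distinct : ∀ {w} → v ≢ w × proj₂ w ≡ f (proj₁ w) → proj₁ v ≢ proj₁ w
      distinct (v≢w , e′) eq = v≢w (cong₂ _,_ eq (trans e (trans (cong f eq) (sym e′))))

≐-∘ : {A B : Set} {P Q : B → Set} (f : A → B) → P ≐ Q → P ∘ f ≐ Q ∘ f
≐-∘ f (P⊆Q , Q⊆P) = P⊆Q , Q⊆P

length-filter+filter∁ : {A : Set} {Q : A → Set} (Q? : Decidable Q) →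
                        ∀ xs → length xs ≡ length (filter Q? xs) ℕ.+ length (filter (∁? Q?) xs)
length-filter+filter∁ Q? []       = refl
length-filter+filter∁ Q? (x ∷ xs) with Q? x
... | yes _ = cong suc (length-filter+filter∁ Q? xs)
... | no _  = trans (cong suc (length-filter+filter∁ Q? xs)) (sym (ℕ.+-suc _ _))

AtLeast-∖ : {A : Set} {P Q : A → Set} {k l : ℕ} → Decidable Q →
            AtLeast (k ℕ.+ l) P → AtMost l Q → AtLeast k (λ x → P x × ¬ Q x)
AtLeast-∖ {k = k} {l} Q? (xs , xs! , Pxs , k+l≤∣xs∣) bound =
  filter (∁? Q?) xs , Unique.filter⁺ (∁? Q?) xs! ,
  All.zip (All.filter⁺ (∁? Q?) Pxs , All.all-filter (∁? Q?) xs) ,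
  ℕ.+-cancelʳ-≤ l k _ (begin
    k ℕ.+ l                              ≤⟨ k+l≤∣xs∣ ⟩
    length xs                            ≡⟨ length-filter+filter∁ Q? xs ⟩
    length (filter Q? xs) ℕ.+ length ys  ≤⟨ ℕ.+-monoˡ-≤ (length ys) Q-bound ⟩
    l ℕ.+ length ys                      ≡⟨ ℕ.+-comm l (length ys) ⟩
    length ys ℕ.+ l                      ∎)
  where
  open ℕ.≤-Reasoning
  ys = filter (∁? Q?) xs
  Q-bound : length (filter Q? xs) ≤ l
  Q-bound = bound (filter Q? xs) (Unique.filter⁺ Q? xs!) (All.all-filter Q? xs)

map-↭ : {A : Set} {xs : List A} (f g : A → A) →
        (∀ x → g (f x) ≡ x) → (∀ y → f (g y) ≡ y) → Unique xs →
        (∀ {x} → x ∈ xs → f x ∈ xs) → (∀ {y} → y ∈ xs → g y ∈ xs) → map f xs ↭ xs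
map-↭ {xs = xs} f g gf fg xs! f∈ g∈ = ∼bag⇒↭ (unique∧set⇒bag
  (Unique.map⁺ (λ {x} {y} e → trans (sym (gf x)) (trans (cong g e) (gf y))) xs!) xs!
  (λ {y} → mk⇔ (λ y∈ → let x , x∈ , y≡fx = ∈.∈-map⁻ f y∈ in subst (_∈ xs) (sym y≡fx) (f∈ x∈))
                (λ y∈ → subst (_∈ map f xs) (fg y) (∈.∈-map⁺ f (g∈ y∈)))))

∣m⊖n∣≡∣m-n∣ : ∀ m n → ℤ.∣ m ⊖ n ∣ ≡ ∣ m - n ∣
∣m⊖n∣≡∣m-n∣ zero    zero    = refl
∣m⊖n∣≡∣m-n∣ zero    (suc n) = refl
∣m⊖n∣≡∣m-n∣ (suc m) zero    = refl
∣m⊖n∣≡∣m-n∣ (suc m) (suc n) = trans (cong ℤ.∣_∣ (ℤ.[1+m]⊖[1+n]≡m⊖n m n)) (∣m⊖n∣≡∣m-n∣ m n)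

m≡n+∣m-n∣⊎n≡m+∣m-n∣ : ∀ m n → m ≡ n ℕ.+ ∣ m - n ∣ ⊎ n ≡ m ℕ.+ ∣ m - n ∣
m≡n+∣m-n∣⊎n≡m+∣m-n∣ m n with ℕ.≤-total n m
... | inj₁ n≤m = inj₁ (sym (trans (cong (n ℕ.+_) (ℕ.m≤n⇒∣n-m∣≡n∸m n≤m)) (ℕ.m+[n∸m]≡n n≤m)))
... | inj₂ m≤n = inj₂ (sym (trans (cong (m ℕ.+_) (ℕ.m≤n⇒∣m-n∣≡n∸m m≤n)) (ℕ.m+[n∸m]≡n m≤n)))

foldr-↭ : {A : Set} {_∙_ : A → A → A} {ε : A} → IsCommutativeMonoid _≡_ _∙_ ε →
          ∀ {xs ys} → xs ↭ ys → foldr _∙_ ε xs ≡ foldr _∙_ ε ys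
foldr-↭ {A} isCommutativeMonoid xs↭ys =
  Permutation.foldr-commMonoid (setoid A) isCommutativeMonoid (↭⇒↭ₛ xs↭ys)

¬2∣n⇒n≡1+k*2 : ∀ n → ¬ 2 ∣ n → ∃[ k ] n ≡ suc (k ℕ.* 2)
¬2∣n⇒n≡1+k*2 n 2∤n with n % 2 | m≡m%n+[m/n]*n n 2 | m%n<n n 2
... | 0           | n≡k*2   | _ = ⊥-elim (2∤n (divides (n / 2) n≡k*2))
... | 1           | n≡1+k*2 | _ = n / 2 , n≡1+k*2
... | suc (suc _) | _       | s≤s (s≤s ())

∣m-n∣<l : ∀ {m n l} → 1 ≤ m → 1 ≤ n → m ≤ l → n ≤ l → ∣ m - n ∣ < l
∣m-n∣<l {suc m} {suc n} _ _ m≤l n≤l = ℕ.<-≤-trans (s≤s (ℕ.∣m-n∣≤m⊔n m n)) (ℕ.⊔-lub m≤l n≤l)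

gcd[d,n]≡n⇒d≡0 : ∀ {d n} → d < n → gcd d n ≡ n → d ≡ 0
gcd[d,n]≡n⇒d≡0 {zero}  _   _          = refl
gcd[d,n]≡n⇒d≡0 {suc d} {n} d<n gcd[d,n]≡n =
  ⊥-elim (ℕ.<⇒≱ d<n (∣⇒≤ (subst (_∣ suc d) gcd[d,n]≡n (gcd[m,n]∣m (suc d) n))))

gcd[m+m,n]≡gcd[2*gcd[m,n],n] : ∀ m n → gcd (m ℕ.+ m) n ≡ gcd (2 ℕ.* gcd m n) n
gcd[m+m,n]≡gcd[2*gcd[m,n],n] m n = sym (begin
  gcd (2 ℕ.* gcd m n) n                ≡⟨ cong (λ z → gcd z n) (c*gcd[m,n]≡gcd[cm,cn] 2 m n) ⟩
  gcd (gcd (2 ℕ.* m) (2 ℕ.* n)) n      ≡⟨ gcd-assoc (2 ℕ.* m) (2 ℕ.* n) n ⟩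
  gcd (2 ℕ.* m) (gcd (2 ℕ.* n) n)      ≡⟨ cong (gcd (2 ℕ.* m)) gcd[2n,n]≡n ⟩
  gcd (2 ℕ.* m) n                      ≡⟨ cong (λ z → gcd (m ℕ.+ z) n) (ℕ.+-identityʳ m) ⟩
  gcd (m ℕ.+ m) n                      ∎)
  where
  open ≡-Reasoning
  gcd[2n,n]≡n : gcd (2 ℕ.* n) n ≡ n
  gcd[2n,n]≡n = ∣-antisym (gcd[m,n]∣n (2 ℕ.* n) n) (gcd-greatest (n∣m*n 2) ∣-refl)

gcdQ-∣m-n∣ : ∀ q m n → gcdQ q (ℤ.+ m ℤ.- ℤ.+ n) ≡ ℤ.+ gcd ∣ m - n ∣ (q ℕ.∸ 1)
gcdQ-∣m-n∣ q m n =
  cong (λ d → ℤ.+ gcd d (q ℕ.∸ 1)) (trans (cong ℤ.∣_∣ (ℤ.[+m]-[+n]≡m⊖n m n)) (∣m⊖n∣≡∣m-n∣ m n))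

Fin⇒≡1+[n∸1] : ∀ {n} → Fin n → n ≡ suc (n ℕ.∸ 1)
Fin⇒≡1+[n∸1] {suc n} _ = refl

module _ {q : ℕ} (F : FiniteField q) where

  open FiniteField F
  open IsCommutativeRing isCommutativeRing
    using ( +-comm; +-assoc; *-comm; *-assoc; +-identityˡ; +-identityʳ; *-identityˡ; *-identityʳ
          ; -‿inverseˡ; -‿inverseʳ; zeroˡ; zeroʳ; +-isCommutativeMonoid; *-isCommutativeMonoid)

  private
    commutativeRing : CommutativeRing 0ℓ 0ℓ
    commutativeRing = record { isCommutativeRing = isCommutativeRing }

  open RingProperties (CommutativeRing.ring commutativeRing)
    using (-‿involutive; +-cancelʳ; +-inverseʳ-unique)
  open SemiringMultiplication (CommutativeRing.semiring commutativeRing) using (×1-homo-*) renaming (_×_ to _·_)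
  open import Algebra.Solver.Ring.NaturalCoefficients.Default
    (CommutativeRing.commutativeSemiring commutativeRing) using (solve; _:=_; _:+_; _:*_; con)

  1≢0 : 1# ≢ 0#
  1≢0 = 0≢1 ∘ sym

  N : ℕ
  N = q ℕ.∸ 1

  q≡1+N : q ≡ suc N
  q≡1+N = Fin⇒≡1+[n∸1] (Inverse.to card 0#)

  card′ : Carrier ↔ Fin (suc N)
  card′ = subst (λ k → Carrier ↔ Fin k) q≡1+N card

  open Inverse card′ using (to; from; strictlyInverseˡ; strictlyInverseʳ)

  to-injective : Injective _≡_ _≡_ to
  to-injective {x} {y} eq = trans (sym (strictlyInverseʳ x)) (trans (cong from eq) (strictlyInverseʳ y))

  infix 4 _≟_
  _≟_ : DecidableEquality Carrier
  x ≟ y = map′ to-injective (cong to) (to x Fin.≟ to y)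

  inv : ∀ x → x ≢ 0# → Carrier
  inv x x≢0 = proj₁ (inverse x x≢0)

  *-inverseʳ : ∀ x (x≢0 : x ≢ 0#) → x * inv x x≢0 ≡ 1#
  *-inverseʳ x x≢0 = proj₂ (inverse x x≢0)

  inv-≢0 : ∀ x (x≢0 : x ≢ 0#) → inv x x≢0 ≢ 0#
  inv-≢0 x x≢0 x⁻¹≡0 = 1≢0 (trans (sym (*-inverseʳ x x≢0)) (trans (cong (x *_) x⁻¹≡0) (zeroʳ x)))

  *-cancelʳ-≢0 : ∀ {a b} c → c ≢ 0# → a * c ≡ b * c → a ≡ b
  *-cancelʳ-≢0 {a} {b} c c≢0 ac≡bc = begin
    a                  ≡⟨ sym (*-identityʳ a) ⟩
    a * 1#             ≡⟨ cong (a *_) (sym (*-inverseʳ c c≢0)) ⟩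
    a * (c * c⁻¹)      ≡⟨ sym (*-assoc a c c⁻¹) ⟩
    a * c * c⁻¹        ≡⟨ cong (_* c⁻¹) ac≡bc ⟩
    b * c * c⁻¹        ≡⟨ *-assoc b c c⁻¹ ⟩
    b * (c * c⁻¹)      ≡⟨ cong (b *_) (*-inverseʳ c c≢0) ⟩
    b * 1#             ≡⟨ *-identityʳ b ⟩
    b                  ∎
    where
    open ≡-Reasoning
    c⁻¹ = inv c c≢0

  *-cancelˡ-≢0 : ∀ {a b} c → c ≢ 0# → c * a ≡ c * b → a ≡ b
  *-cancelˡ-≢0 {a} {b} c c≢0 ca≡cb = *-cancelʳ-≢0 c c≢0 (trans (*-comm a c) (trans ca≡cb (*-comm c b)))

  *-≢0 : ∀ {x y} → x ≢ 0# → y ≢ 0# → x * y ≢ 0#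
  *-≢0 {x} {y} x≢0 y≢0 xy≡0 = y≢0 (*-cancelˡ-≢0 x x≢0 (trans xy≡0 (sym (zeroʳ x))))

  zero-product : ∀ {x y} → x * y ≡ 0# → x ≡ 0# ⊎ y ≡ 0#
  zero-product {x} {y} xy≡0 with x ≟ 0# | y ≟ 0#
  ... | yes x≡0 | _       = inj₁ x≡0
  ... | no _    | yes y≡0 = inj₂ y≡0
  ... | no x≢0  | no y≢0  = ⊥-elim (*-≢0 x≢0 y≢0 xy≡0)

  x-y≡0⇒x≡y : ∀ {x y} → x + - y ≡ 0# → x ≡ y
  x-y≡0⇒x≡y {x} {y} x-y≡0 = +-cancelʳ (- y) x y (trans x-y≡0 (sym (-‿inverseʳ y)))

  x≡y⇒x-y≡0 : ∀ {x y} → x ≡ y → x + - y ≡ 0#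
  x≡y⇒x-y≡0 {y = y} refl = -‿inverseʳ y

  x+[y-x]≡y : ∀ x y → x + (y + - x) ≡ y
  x+[y-x]≡y x y = trans (cong (x +_) (+-comm y (- x)))
    (trans (sym (+-assoc x (- x) y)) (trans (cong (_+ y) (-‿inverseʳ x)) (+-identityˡ y)))

  [x-y]+y≡x : ∀ x y → x + - y + y ≡ x
  [x-y]+y≡x x y = trans (+-assoc x (- y) y) (trans (cong (x +_) (-‿inverseˡ y)) (+-identityʳ x))

  ^ᶠ-homo-* : ∀ x m n → x ^ᶠ (m ℕ.+ n) ≡ x ^ᶠ m * x ^ᶠ n
  ^ᶠ-homo-* x zero    n = sym (*-identityˡ _)
  ^ᶠ-homo-* x (suc m) n = trans (cong (x *_) (^ᶠ-homo-* x m n)) (sym (*-assoc x _ _))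

  ^ᶠ-distrib-* : ∀ x y n → (x * y) ^ᶠ n ≡ x ^ᶠ n * y ^ᶠ n
  ^ᶠ-distrib-* x y zero    = sym (*-identityʳ 1#)
  ^ᶠ-distrib-* x y (suc n) = trans (cong ((x * y) *_) (^ᶠ-distrib-* x y n))
    (solve 4 (λ x y a b → (x :* y) :* (a :* b) := (x :* a) :* (y :* b)) refl x y (x ^ᶠ n) (y ^ᶠ n))

  1^ᶠ : ∀ n → 1# ^ᶠ n ≡ 1#
  1^ᶠ zero    = refl
  1^ᶠ (suc n) = trans (*-identityˡ _) (1^ᶠ n)

  0^[1+m]*x≡0 : ∀ m x → 0# ^ᶠ suc m * x ≡ 0#
  0^[1+m]*x≡0 m x = trans (cong (_* x) (zeroˡ _)) (zeroˡ x)

  x*0^[1+n]≡0 : ∀ x n → x * 0# ^ᶠ suc n ≡ 0#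
  x*0^[1+n]≡0 x n = trans (cong (x *_) (zeroˡ _)) (zeroʳ x)

  x*1^n≡x : ∀ x n → x * 1# ^ᶠ n ≡ x
  x*1^n≡x x n = trans (cong (x *_) (1^ᶠ n)) (*-identityʳ x)

  1^m*x≡x : ∀ m x → 1# ^ᶠ m * x ≡ x
  1^m*x≡x m x = trans (cong (_* x) (1^ᶠ m)) (*-identityˡ x)

  ^ᶠ-≢0 : ∀ {x} n → x ≢ 0# → x ^ᶠ n ≢ 0#
  ^ᶠ-≢0 zero    x≢0 = 1≢0
  ^ᶠ-≢0 (suc n) x≢0 = *-≢0 x≢0 (^ᶠ-≢0 n x≢0)

  x^n≡1⇒x^[c*n]≡1 : ∀ x n c → x ^ᶠ n ≡ 1# → x ^ᶠ (c ℕ.* n) ≡ 1#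
  x^n≡1⇒x^[c*n]≡1 x n zero    _      = refl
  x^n≡1⇒x^[c*n]≡1 x n (suc c) x^n≡1 = begin
    x ^ᶠ (n ℕ.+ c ℕ.* n)        ≡⟨ ^ᶠ-homo-* x n (c ℕ.* n) ⟩
    x ^ᶠ n * x ^ᶠ (c ℕ.* n)     ≡⟨ cong₂ _*_ x^n≡1 (x^n≡1⇒x^[c*n]≡1 x n c x^n≡1) ⟩
    1# * 1#                     ≡⟨ *-identityˡ 1# ⟩
    1#                          ∎
    where open ≡-Reasoning

  x^[m+n]≡1⇒x^m≡1 : ∀ x m n → x ^ᶠ n ≡ 1# → x ^ᶠ (m ℕ.+ n) ≡ 1# → x ^ᶠ m ≡ 1#
  x^[m+n]≡1⇒x^m≡1 x m n x^n≡1 x^[m+n]≡1 = begin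
    x ^ᶠ m               ≡⟨ sym (*-identityʳ _) ⟩
    x ^ᶠ m * 1#          ≡⟨ cong (x ^ᶠ m *_) (sym x^n≡1) ⟩
    x ^ᶠ m * x ^ᶠ n      ≡⟨ sym (^ᶠ-homo-* x m n) ⟩
    x ^ᶠ (m ℕ.+ n)       ≡⟨ x^[m+n]≡1 ⟩
    1#                   ∎
    where open ≡-Reasoning

  x^d≡1⇒x^[m+d]≡x^m : ∀ {x} m d → x ^ᶠ d ≡ 1# → x ^ᶠ (m ℕ.+ d) ≡ x ^ᶠ m
  x^d≡1⇒x^[m+d]≡x^m {x} m d x^d≡1 =
    trans (^ᶠ-homo-* x m d) (trans (cong (x ^ᶠ m *_) x^d≡1) (*-identityʳ _))

  x^[m+d]≡x^m⇒x^d≡1 : ∀ {x} m d → x ≢ 0# → x ^ᶠ (m ℕ.+ d) ≡ x ^ᶠ m → x ^ᶠ d ≡ 1#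
  x^[m+d]≡x^m⇒x^d≡1 {x} m d x≢0 eq = *-cancelˡ-≢0 (x ^ᶠ m) (^ᶠ-≢0 m x≢0)
    (trans (sym (^ᶠ-homo-* x m d)) (trans eq (sym (*-identityʳ _))))

  nonzeros : List Carrier
  nonzeros = tabulate (from ∘ punchIn (to 0#))

  from-injective : Injective _≡_ _≡_ from
  from-injective {i} {j} eq = trans (sym (strictlyInverseˡ i)) (trans (cong to eq) (strictlyInverseˡ j))

  nonzeros-unique : Unique nonzeros
  nonzeros-unique = Unique.tabulate⁺ (Fin.punchIn-injective _ _ _ ∘ from-injective)

  length-nonzeros : length nonzeros ≡ N
  length-nonzeros = List.length-tabulate _

  nonzeros-≢0 : All (_≢ 0#) nonzeros
  nonzeros-≢0 = All.tabulate⁺ λ i eq →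
    Fin.punchInᵢ≢i (to 0#) i (trans (sym (strictlyInverseˡ _)) (cong to eq))

  ∈-nonzeros : ∀ {x} → x ≢ 0# → x ∈ nonzeros
  ∈-nonzeros {x} x≢0 = subst (_∈ nonzeros) from-to-x (∈.∈-tabulate⁺ (Fin.punchOut to0≢tox))
    where
    to0≢tox : to 0# ≢ to x
    to0≢tox = x≢0 ∘ sym ∘ to-injective
    from-to-x : from (punchIn (to 0#) (Fin.punchOut to0≢tox)) ≡ x
    from-to-x = trans (cong from (Fin.punchIn-punchOut to0≢tox)) (strictlyInverseʳ x)

  elements : List Carrier
  elements = 0# ∷ nonzeros

  elements-unique : Unique elements
  elements-unique = All.map (λ x≢0 → x≢0 ∘ sym) nonzeros-≢0 ∷ nonzeros-unique

  ∈-elements : ∀ x → x ∈ elements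
  ∈-elements x with x ≟ 0#
  ... | yes refl = here refl
  ... | no x≢0   = there (∈-nonzeros x≢0)

  product : List Carrier → Carrier
  product = foldr _*_ 1#

  product-map-* : ∀ a xs → product (map (a *_) xs) ≡ a ^ᶠ length xs * product xs
  product-map-* a []       = sym (*-identityʳ 1#)
  product-map-* a (x ∷ xs) = trans (cong ((a * x) *_) (product-map-* a xs))
    (solve 4 (λ a x p r → (a :* x) :* (p :* r) := (a :* p) :* (x :* r)) refl a x (a ^ᶠ length xs) (product xs))

  product-≢0 : ∀ {xs} → All (_≢ 0#) xs → product xs ≢ 0#
  product-≢0 []           = 1≢0
  product-≢0 (x≢0 ∷ xs≢0) = *-≢0 x≢0 (product-≢0 xs≢0)

  fermat : ∀ {a} → a ≢ 0# → a ^ᶠ N ≡ 1#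
  fermat {a} a≢0 = *-cancelʳ-≢0 (product nonzeros) (product-≢0 nonzeros-≢0) (begin
    a ^ᶠ N * product nonzeros                 ≡⟨ cong (λ k → a ^ᶠ k * product nonzeros) (sym length-nonzeros) ⟩
    a ^ᶠ length nonzeros * product nonzeros   ≡⟨ sym (product-map-* a nonzeros) ⟩
    product (map (a *_) nonzeros)             ≡⟨ foldr-↭ *-isCommutativeMonoid a*-permutes ⟩
    product nonzeros                          ≡⟨ sym (*-identityˡ _) ⟩
    1# * product nonzeros                     ∎)
    where
    open ≡-Reasoning
    a⁻¹ = inv a a≢0
    a*a⁻¹≡1 = *-inverseʳ a a≢0
    cancel : ∀ b c → b * c ≡ 1# → ∀ x → c * (b * x) ≡ x
    cancel b c bc≡1 x = trans (solve 3 (λ b c x → c :* (b :* x) := (b :* c) :* x) refl b c x)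
                              (trans (cong (_* x) bc≡1) (*-identityˡ x))
    a*-permutes : map (a *_) nonzeros ↭ nonzeros
    a*-permutes = map-↭ (a *_) (a⁻¹ *_) (cancel a a⁻¹ a*a⁻¹≡1)
      (cancel a⁻¹ a (trans (*-comm a⁻¹ a) a*a⁻¹≡1)) nonzeros-unique
      (λ x∈ → ∈-nonzeros (*-≢0 a≢0 (All.lookup nonzeros-≢0 x∈)))
      (λ x∈ → ∈-nonzeros (*-≢0 (inv-≢0 a a≢0) (All.lookup nonzeros-≢0 x∈)))

  sum : List Carrier → Carrier
  sum = foldr _+_ 0#

  sum-map-1+ : ∀ xs → sum (map (1# +_) xs) ≡ length xs · 1# + sum xs
  sum-map-1+ []       = sym (+-identityʳ 0#)
  sum-map-1+ (x ∷ xs) = trans (cong ((1# + x) +_) (sum-map-1+ xs))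
    (solve 4 (λ o x n s → (o :+ x) :+ (n :+ s) := (o :+ n) :+ (x :+ s)) refl 1# x (length xs · 1#) (sum xs))

  [1+N]·1≡0 : suc N · 1# ≡ 0#
  [1+N]·1≡0 = +-cancelʳ (sum elements) _ _ (begin
    suc N · 1# + sum elements            ≡⟨ cong (λ k → suc k · 1# + sum elements) (sym length-nonzeros) ⟩
    length elements · 1# + sum elements  ≡⟨ sym (sum-map-1+ elements) ⟩
    sum (map (1# +_) elements)           ≡⟨ foldr-↭ +-isCommutativeMonoid 1+-permutes ⟩
    sum elements                         ≡⟨ sym (+-identityˡ _) ⟩
    0# + sum elements                    ∎)
    where
    open ≡-Reasoning
    cancel : ∀ b c → b + c ≡ 0# → ∀ x → c + (b + x) ≡ x
    cancel b c b+c≡0 x = trans (solve 3 (λ b c x → c :+ (b :+ x) := (b :+ c) :+ x) refl b c x)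
                              (trans (cong (_+ x) b+c≡0) (+-identityˡ x))
    1+-permutes : map (1# +_) elements ↭ elements
    1+-permutes = map-↭ (1# +_) (- 1# +_) (cancel 1# (- 1#) (-‿inverseʳ 1#))
      (cancel (- 1#) 1# (-‿inverseˡ 1#)) elements-unique (λ _ → ∈-elements _) (λ _ → ∈-elements _)

  1+1≢0 : ¬ 2 ∣ q → 1# + 1# ≢ 0#
  1+1≢0 2∤q 1+1≡0 = 1≢0 (begin
    1#                              ≡⟨ sym (+-identityʳ 1#) ⟩
    1# + 0#                         ≡⟨ cong (1# +_) (sym (zeroʳ (k · 1#))) ⟩
    1# + (k · 1#) * 0#              ≡⟨ cong (λ z → 1# + (k · 1#) * z) (sym 2·1≡0) ⟩
    1# + (k · 1#) * (2 · 1#)        ≡⟨ cong (1# +_) (sym (×1-homo-* k 2)) ⟩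
    suc (k ℕ.* 2) · 1#              ≡⟨ cong (_· 1#) (sym 1+N≡1+k*2) ⟩
    suc N · 1#                      ≡⟨ [1+N]·1≡0 ⟩
    0#                              ∎)
    where
    open ≡-Reasoning
    odd = ¬2∣n⇒n≡1+k*2 (suc N) (subst (λ n → ¬ 2 ∣ n) q≡1+N 2∤q)
    k = proj₁ odd
    1+N≡1+k*2 = proj₂ odd
    2·1≡0 : 2 · 1# ≡ 0#
    2·1≡0 = trans (cong (1# +_) (+-identityʳ 1#)) 1+1≡0

  -- Monic polynomial functions

  data Monic : ℕ → (Carrier → Carrier) → Set where
    one    : ∀ {f} → (∀ x → f x ≡ 1#) → Monic 0 f
    horner : ∀ {k f} c g → Monic k g → (∀ x → f x ≡ c + x * g x) → Monic (suc k) f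

  Monic-≗ : ∀ {k f h} → (∀ x → f x ≡ h x) → Monic k f → Monic k h
  Monic-≗ f≗h (one f≡1)          = one (λ x → trans (sym (f≗h x)) (f≡1 x))
  Monic-≗ f≗h (horner c g Mg f≡) = horner c g Mg (λ x → trans (sym (f≗h x)) (f≡ x))

  Monic-x* : ∀ {k g} → Monic k g → Monic (suc k) (λ x → x * g x)
  Monic-x* {g = g} Mg = horner 0# g Mg (λ x → sym (+-identityˡ _))

  Monic-+c : ∀ {k f} c → Monic (suc k) f → Monic (suc k) (λ x → f x + c)
  Monic-+c c (horner c′ g Mg f≡) = horner (c′ + c) g Mg (λ x → trans (cong (_+ c) (f≡ x))
    (solve 3 (λ c′ c xg → c′ :+ xg :+ c := c′ :+ c :+ xg) refl c′ c (x * g x)))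

  Monic-^ : ∀ k → Monic k (_^ᶠ k)
  Monic-^ zero    = one (λ _ → refl)
  Monic-^ (suc k) = Monic-x* (Monic-^ k)

  Monic-^* : ∀ j {k g} → Monic k g → Monic (j ℕ.+ k) (λ x → x ^ᶠ j * g x)
  Monic-^* zero    Mg = Monic-≗ (λ x → sym (*-identityˡ _)) Mg
  Monic-^* (suc j) Mg = Monic-≗ (λ x → sym (*-assoc x _ _)) (Monic-x* (Monic-^* j Mg))

  Monic-^+c : ∀ {k} → k ≢ 0 → ∀ c → Monic k (λ x → x ^ᶠ k + c)
  Monic-^+c {zero}  0≢0 c = ⊥-elim (0≢0 refl)
  Monic-^+c {suc k} _   c = Monic-+c c (Monic-^ (suc k))

  -- Synthetic division by x - a: f x - f a = (x - a) * g x, with the subtractions moved across.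
  Monic-divide : ∀ {k f} → Monic (suc k) f → ∀ a →
                 ∃[ g ] Monic k g × (∀ x → f x + a * g x ≡ x * g x + f a)
  Monic-divide {f = f} (horner c g (one g≡1) f≡) a = g , one g≡1 , λ x → begin
    f x + a * g x             ≡⟨ cong₂ (λ u v → u + a * v) (f≡ x) (trans (g≡1 x) (sym (g≡1 a))) ⟩
    c + x * g x + a * g a
      ≡⟨ solve 4 (λ c xg a ga → c :+ xg :+ a :* ga := xg :+ (c :+ a :* ga)) refl c (x * g x) a (g a) ⟩
    x * g x + (c + a * g a)   ≡⟨ cong (x * g x +_) (sym (f≡ a)) ⟩
    x * g x + f a             ∎
    where open ≡-Reasoning
  Monic-divide {f = f} (horner c g Mg@(horner _ _ _ _) f≡) a with Monic-divide Mg a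
  ... | g′ , Mg′ , g-division = h , horner (g a) g′ Mg′ (λ _ → refl) , λ x → begin
    f x + a * h x                          ≡⟨ cong (_+ a * h x) (f≡ x) ⟩
    c + x * g x + a * (g a + x * g′ x)
      ≡⟨ solve 6 (λ c x a gx ga g′x → c :+ x :* gx :+ a :* (ga :+ x :* g′x) := c :+ a :* ga :+ x :* (gx :+ a :* g′x))
               refl c x a (g x) (g a) (g′ x) ⟩
    c + a * g a + x * (g x + a * g′ x)     ≡⟨ cong (λ v → c + a * g a + x * v) (g-division x) ⟩
    c + a * g a + x * (x * g′ x + g a)
      ≡⟨ solve 5 (λ c x a ga g′x → c :+ a :* ga :+ x :* (x :* g′x :+ ga) := x :* (ga :+ x :* g′x) :+ (c :+ a :* ga))
               refl c x a (g a) (g′ x) ⟩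
    x * h x + (c + a * g a)                ≡⟨ cong (x * h x +_) (sym (f≡ a)) ⟩
    x * h x + f a                          ∎
    where
    open ≡-Reasoning
    h = λ x → g a + x * g′ x

  Monic-roots : ∀ {k f} → Monic k f → AtMost k (λ x → f x ≡ 0#)
  Monic-roots (one f≡1)        []       _ _             = z≤n
  Monic-roots (one f≡1)        (x ∷ _)  _ (fx≡0 ∷ _)    = ⊥-elim (1≢0 (trans (sym (f≡1 x)) fx≡0))
  Monic-roots (horner _ _ _ _) []       _ _             = z≤n
  Monic-roots {f = f} Mf@(horner _ _ _ _) (a ∷ as) (a∉as ∷ as!) (fa≡0 ∷ fas≡0)
    with Monic-divide Mf a
  ... | g , Mg , division = s≤s (Monic-roots Mg as as! (All.zipWith root-of-g (a∉as , fas≡0)))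
    where
    root-of-g : ∀ {b} → a ≢ b × f b ≡ 0# → g b ≡ 0#
    root-of-g {b} (a≢b , fb≡0) with g b ≟ 0#
    ... | yes gb≡0 = gb≡0
    ... | no gb≢0  = ⊥-elim (a≢b (*-cancelʳ-≢0 (g b) gb≢0 (begin
      a * g b          ≡⟨ sym (+-identityˡ _) ⟩
      0# + a * g b     ≡⟨ cong (_+ a * g b) (sym fb≡0) ⟩
      f b + a * g b    ≡⟨ division b ⟩
      b * g b + f a    ≡⟨ cong (b * g b +_) fa≡0 ⟩
      b * g b + 0#     ≡⟨ +-identityʳ _ ⟩
      b * g b          ∎)))
      where open ≡-Reasoning

  -- Roots of unity

  geometric : ℕ → ℕ → Carrier → Carrier
  geometric d zero    x = 1#
  geometric d (suc j) x = x ^ᶠ d * geometric d j x + 1#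

  Monic-geometric : ∀ d j → Monic (j ℕ.* suc d) (geometric (suc d) j)
  Monic-geometric d zero    = one (λ _ → refl)
  Monic-geometric d (suc j) = Monic-+c 1# (Monic-^* (suc d) (Monic-geometric d j))

  [x^d-1]*geometric≡x^[[1+j]*d]-1 : ∀ d j x →
    (x ^ᶠ d + - 1#) * geometric d j x ≡ x ^ᶠ (suc j ℕ.* d) + - 1#
  [x^d-1]*geometric≡x^[[1+j]*d]-1 d zero    x =
    trans (*-identityʳ _) (cong (λ k → x ^ᶠ k + - 1#) (sym (ℕ.+-identityʳ d)))
  [x^d-1]*geometric≡x^[[1+j]*d]-1 d (suc j) x = begin
    (x^d + - 1#) * (x^d * h + 1#)
      ≡⟨ solve 3 (λ y m h → (y :+ m) :* (y :* h :+ con 1) := y :* ((y :+ m) :* h) :+ (y :+ m)) refl x^d (- 1#) h ⟩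
    x^d * ((x^d + - 1#) * h) + (x^d + - 1#)
      ≡⟨ cong (λ z → x^d * z + (x^d + - 1#)) ([x^d-1]*geometric≡x^[[1+j]*d]-1 d j x) ⟩
    x^d * (x^[[1+j]*d] + - 1#) + (x^d + - 1#)
      ≡⟨ solve 3 (λ y m p → y :* (p :+ m) :+ (y :+ m) := (y :* p :+ m) :+ y :* (m :+ con 1))
               refl x^d (- 1#) x^[[1+j]*d] ⟩
    x^d * x^[[1+j]*d] + - 1# + x^d * (- 1# + 1#)
      ≡⟨ cong (λ z → x^d * x^[[1+j]*d] + - 1# + x^d * z) (-‿inverseˡ 1#) ⟩
    x^d * x^[[1+j]*d] + - 1# + x^d * 0#
      ≡⟨ trans (cong (x^d * x^[[1+j]*d] + - 1# +_) (zeroʳ x^d)) (+-identityʳ _) ⟩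
    x^d * x^[[1+j]*d] + - 1#
      ≡⟨ cong (_+ - 1#) (sym (^ᶠ-homo-* x d (suc j ℕ.* d))) ⟩
    x ^ᶠ (suc (suc j) ℕ.* d) + - 1#  ∎
    where
    open ≡-Reasoning
    x^d = x ^ᶠ d
    h = geometric d j x
    x^[[1+j]*d] = x ^ᶠ (suc j ℕ.* d)

  N≢0 : N ≢ 0
  N≢0 N≡0 = nonempty (∈-nonzeros 1≢0) (trans length-nonzeros N≡0)
    where
    nonempty : ∀ {xs : List Carrier} {x} → x ∈ xs → length xs ≢ 0
    nonempty {_ ∷ _} _ ()

  -- Every nonzero x is a root of x^N - 1 = (x^d - 1) * geometric d j x,
  -- and the second factor has at most N - d roots.
  AtLeast-roots-of-unity-∣ : ∀ {d} → d ∣ N → AtLeast d (λ x → x ≢ 0# × x ^ᶠ d ≡ 1#)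
  AtLeast-roots-of-unity-∣ {zero}   _                      = [] , [] , [] , z≤n
  AtLeast-roots-of-unity-∣ {suc d′} (divides zero N≡0)     = ⊥-elim (N≢0 N≡0)
  AtLeast-roots-of-unity-∣ {suc d′} (divides (suc j) N≡d+jd) =
    AtLeast-⊆ (λ { ((x≢0 , inj₁ x^d≡1) , _) → x≢0 , x^d≡1
                 ; ((_ , inj₂ h≡0) , h≢0) → ⊥-elim (h≢0 h≡0) })
      (AtLeast-∖ (λ x → geometric d j x ≟ 0#) nonzeros-split (Monic-roots (Monic-geometric d′ j)))
    where
    d = suc d′
    root-of-a-factor : ∀ {x} → x ≢ 0# → x ^ᶠ d ≡ 1# ⊎ geometric d j x ≡ 0#
    root-of-a-factor {x} x≢0 with zero-product (trans ([x^d-1]*geometric≡x^[[1+j]*d]-1 d j x)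
      (x≡y⇒x-y≡0 (trans (cong (x ^ᶠ_) (sym N≡d+jd)) (fermat x≢0))))
    ... | inj₁ x^d-1≡0 = inj₁ (x-y≡0⇒x≡y x^d-1≡0)
    ... | inj₂ h≡0     = inj₂ h≡0
    nonzeros-split : AtLeast (d ℕ.+ j ℕ.* d) (λ x → x ≢ 0# × (x ^ᶠ d ≡ 1# ⊎ geometric d j x ≡ 0#))
    nonzeros-split = nonzeros , nonzeros-unique ,
      All.map (λ x≢0 → x≢0 , root-of-a-factor x≢0) nonzeros-≢0 ,
      ℕ.≤-reflexive (trans (sym N≡d+jd) (sym length-nonzeros))

  gcdN : ℕ → ℕ
  gcdN k = gcd k N

  gcdN≢0 : ∀ k → gcdN k ≢ 0
  gcdN≢0 k = gcd[m,n]≢0 k N (inj₂ N≢0)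

  Bézout⇒x^d≡1 : ∀ {x d m n} a b → x ^ᶠ m ≡ 1# → x ^ᶠ n ≡ 1# → d ℕ.+ a ℕ.* m ≡ b ℕ.* n → x ^ᶠ d ≡ 1#
  Bézout⇒x^d≡1 {x} {d} {m} {n} a b x^m≡1 x^n≡1 d+am≡bn =
    x^[m+n]≡1⇒x^m≡1 x d (a ℕ.* m) (x^n≡1⇒x^[c*n]≡1 x m a x^m≡1)
      (trans (cong (x ^ᶠ_) d+am≡bn) (x^n≡1⇒x^[c*n]≡1 x n b x^n≡1))

  x^k≡1⇒x^gcdN≡1 : ∀ {x} k → x ≢ 0# → x ^ᶠ k ≡ 1# → x ^ᶠ gcdN k ≡ 1#
  x^k≡1⇒x^gcdN≡1 {x} k x≢0 x^k≡1 with Bézout.identity (gcd-GCD k N)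
  ... | Bézout.+- a b g+bN≡ak = Bézout⇒x^d≡1 b a (fermat x≢0) x^k≡1 g+bN≡ak
  ... | Bézout.-+ a b g+ak≡bN = Bézout⇒x^d≡1 a b x^k≡1 (fermat x≢0) g+ak≡bN

  x^gcdN≡1⇒x^k≡1 : ∀ {x} k → x ^ᶠ gcdN k ≡ 1# → x ^ᶠ k ≡ 1#
  x^gcdN≡1⇒x^k≡1 {x} k x^g≡1 with gcd[m,n]∣m k N
  ... | divides c k≡cg = trans (cong (x ^ᶠ_) k≡cg) (x^n≡1⇒x^[c*n]≡1 x (gcdN k) c x^g≡1)

  AtLeast-roots-of-unity : ∀ k → AtLeast (gcdN k) (λ x → x ≢ 0# × x ^ᶠ k ≡ 1#)
  AtLeast-roots-of-unity k = AtLeast-⊆ (λ (x≢0 , x^g≡1) → x≢0 , x^gcdN≡1⇒x^k≡1 k x^g≡1)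
    (AtLeast-roots-of-unity-∣ (gcd[m,n]∣n k N))

  ^ᶠ≡0⇒≡0 : ∀ {x} k → x ^ᶠ k ≡ 0# → x ≡ 0#
  ^ᶠ≡0⇒≡0 {x} k x^k≡0 with x ≟ 0#
  ... | yes x≡0 = x≡0
  ... | no x≢0  = ⊥-elim (^ᶠ-≢0 k x≢0 x^k≡0)

  x^k≡y^k⇒x^gcdN≡y^gcdN : ∀ {x y} k → 1 ≤ k → x ^ᶠ k ≡ y ^ᶠ k → x ^ᶠ gcdN k ≡ y ^ᶠ gcdN k
  x^k≡y^k⇒x^gcdN≡y^gcdN {x} {y} (suc k) _ x^k≡y^k with y ≟ 0#
  ... | yes refl = cong (_^ᶠ gcdN (suc k)) (^ᶠ≡0⇒≡0 (suc k) (trans x^k≡y^k (zeroˡ _)))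
  ... | no y≢0   = begin
    x ^ᶠ g               ≡⟨ cong (_^ᶠ g) (sym t*y≡x) ⟩
    (t * y) ^ᶠ g         ≡⟨ ^ᶠ-distrib-* t y g ⟩
    t ^ᶠ g * y ^ᶠ g      ≡⟨ cong (_* y ^ᶠ g) (x^k≡1⇒x^gcdN≡1 (suc k) t≢0 t^k≡1) ⟩
    1# * y ^ᶠ g          ≡⟨ *-identityˡ _ ⟩
    y ^ᶠ g               ∎
    where
    open ≡-Reasoning
    g = gcdN (suc k)
    y⁻¹ = inv y y≢0
    t = x * y⁻¹
    t*y≡x : t * y ≡ x
    t*y≡x = trans (*-assoc x y⁻¹ y) (trans (cong (x *_) (trans (*-comm y⁻¹ y) (*-inverseʳ y y≢0))) (*-identityʳ x))
    x≢0 : x ≢ 0#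
    x≢0 x≡0 = ^ᶠ-≢0 (suc k) y≢0 (trans (sym x^k≡y^k) (trans (cong (_^ᶠ suc k) x≡0) (zeroˡ _)))
    t≢0 : t ≢ 0#
    t≢0 = *-≢0 x≢0 (inv-≢0 y y≢0)
    t^k≡1 : t ^ᶠ suc k ≡ 1#
    t^k≡1 = begin
      t ^ᶠ suc k                      ≡⟨ ^ᶠ-distrib-* x y⁻¹ (suc k) ⟩
      x ^ᶠ suc k * y⁻¹ ^ᶠ suc k       ≡⟨ cong (_* y⁻¹ ^ᶠ suc k) x^k≡y^k ⟩
      y ^ᶠ suc k * y⁻¹ ^ᶠ suc k       ≡⟨ sym (^ᶠ-distrib-* y y⁻¹ (suc k)) ⟩
      (y * y⁻¹) ^ᶠ suc k              ≡⟨ cong (_^ᶠ suc k) (*-inverseʳ y y≢0) ⟩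
      1# ^ᶠ suc k                     ≡⟨ 1^ᶠ (suc k) ⟩
      1#                              ∎

  AtMost-fiber : ∀ k → 1 ≤ k → ∀ c → AtMost (gcdN k) (λ x → x ^ᶠ k ≡ c)
  AtMost-fiber k 1≤k c []        _   _                        = z≤n
  AtMost-fiber k 1≤k c (x₀ ∷ xs) xs! (x₀^k≡c ∷ xs^k≡c) =
    Monic-roots (Monic-^+c (gcdN≢0 k) (- (x₀ ^ᶠ gcdN k))) (x₀ ∷ xs) xs!
      (x≡y⇒x-y≡0 refl ∷ All.map (λ x^k≡c → x≡y⇒x-y≡0
        (x^k≡y^k⇒x^gcdN≡y^gcdN k 1≤k (trans x^k≡c (sym x₀^k≡c)))) xs^k≡c)

  x^m≡x^n⇒x^∣m-n∣≡1 : ∀ {x} m n → x ≢ 0# → x ^ᶠ m ≡ x ^ᶠ n → x ^ᶠ ∣ m - n ∣ ≡ 1#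
  x^m≡x^n⇒x^∣m-n∣≡1 {x} m n x≢0 x^m≡x^n with m≡n+∣m-n∣⊎n≡m+∣m-n∣ m n
  ... | inj₁ m≡n+d = x^[m+d]≡x^m⇒x^d≡1 n _ x≢0 (trans (cong (x ^ᶠ_) (sym m≡n+d)) x^m≡x^n)
  ... | inj₂ n≡m+d = x^[m+d]≡x^m⇒x^d≡1 m _ x≢0 (trans (cong (x ^ᶠ_) (sym n≡m+d)) (sym x^m≡x^n))

  x^∣m-n∣≡1⇒x^m≡x^n : ∀ {x} m n → x ^ᶠ ∣ m - n ∣ ≡ 1# → x ^ᶠ m ≡ x ^ᶠ n
  x^∣m-n∣≡1⇒x^m≡x^n {x} m n x^d≡1 with m≡n+∣m-n∣⊎n≡m+∣m-n∣ m n
  ... | inj₁ m≡n+d = trans (cong (x ^ᶠ_) m≡n+d) (x^d≡1⇒x^[m+d]≡x^m n _ x^d≡1)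
  ... | inj₂ n≡m+d = sym (trans (cong (x ^ᶠ_) n≡m+d) (x^d≡1⇒x^[m+d]≡x^m m _ x^d≡1))

  record ArcIso (m₁ n₁ m₂ n₂ : ℕ) : Set where
    field
      φ ψ  : Point → Point
      φ∘ψ  : ∀ v → φ (ψ v) ≡ v
      ψ∘φ  : ∀ u → ψ (φ u) ≡ u
      arc→ : ∀ {u v} → Arc m₁ n₁ u v → Arc m₂ n₂ (φ u) (φ v)
      arc← : ∀ {u v} → Arc m₂ n₂ (φ u) (φ v) → Arc m₁ n₁ u v

    φ-injective : Injective _≡_ _≡_ φ
    φ-injective {u} {w} φu≡φw = trans (sym (ψ∘φ u)) (trans (cong ψ φu≡φw) (ψ∘φ w))

  toArcIso : ∀ {m₁ n₁ m₂ n₂} → DigraphIso F m₁ n₁ m₂ n₂ → ArcIso m₁ n₁ m₂ n₂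
  toArcIso (bij , arc⇔) = record
    { φ = Inverse.to bij ; ψ = Inverse.from bij
    ; φ∘ψ = Inverse.strictlyInverseˡ bij ; ψ∘φ = Inverse.strictlyInverseʳ bij
    ; arc→ = Equivalence.to (arc⇔ _ _) ; arc← = Equivalence.from (arc⇔ _ _) }

  ArcIso-sym : ∀ {m₁ n₁ m₂ n₂} → ArcIso m₁ n₁ m₂ n₂ → ArcIso m₂ n₂ m₁ n₁
  ArcIso-sym {m₂ = m₂} {n₂} I = record
    { φ = ψ ; ψ = φ ; φ∘ψ = ψ∘φ ; ψ∘φ = φ∘ψ
    ; arc→ = λ a → arc← (subst₂ (Arc m₂ n₂) (sym (φ∘ψ _)) (sym (φ∘ψ _)) a)
    ; arc← = λ a → subst₂ (Arc m₂ n₂) (φ∘ψ _) (φ∘ψ _) (arc→ a) }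
    where open ArcIso I

  Arc-reverse : ∀ m n {u v} → Arc m n u v → Arc n m v u
  Arc-reverse m n {x₁ , x₂} {y₁ , y₂} arc = trans (+-comm y₂ x₂) (trans arc (*-comm _ _))

  ArcIso-reverse : ∀ {m₁ n₁ m₂ n₂} → ArcIso m₁ n₁ m₂ n₂ → ArcIso n₁ m₁ n₂ m₂
  ArcIso-reverse {m₁} {n₁} {m₂} {n₂} I = record
    { φ = φ ; ψ = ψ ; φ∘ψ = φ∘ψ ; ψ∘φ = ψ∘φ
    ; arc→ = Arc-reverse m₂ n₂ ∘ arc→ ∘ Arc-reverse n₁ m₁
    ; arc← = Arc-reverse m₁ n₁ ∘ arc← ∘ Arc-reverse n₂ m₂ }
    where open ArcIso I

  Out In : ℕ → ℕ → Point → Point → Set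
  Out m n u w = Arc m n u w
  In  m n v w = Arc m n w v

  Twins : ℕ → ℕ → Point → Point → Set
  Twins m n u w = Out m n u ≐ Out m n w

  TwoCycle : ℕ → ℕ → Point → Point → Set
  TwoCycle m n u v = Arc m n u v × Arc m n v u

  OutIsIn : ℕ → ℕ → Point → Set
  OutIsIn m n u = ∃[ v ] Out m n u ≐ In m n v

  LoopSuccessor : ℕ → ℕ → Point → Point → Set
  LoopSuccessor m n u v = Arc m n u v × Arc m n v v

  module _ {m₁ n₁ m₂ n₂} (I : ArcIso m₁ n₁ m₂ n₂) where
    open ArcIso I

    Out-φ : ∀ u → Out m₂ n₂ (φ u) ≐ Out m₁ n₁ u ∘ ψ
    Out-φ u = (λ {w} a → arc← (subst (Arc m₂ n₂ (φ u)) (sym (φ∘ψ w)) a))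
            , (λ {w} a → subst (Arc m₂ n₂ (φ u)) (φ∘ψ w) (arc→ a))

    In-φ : ∀ v → In m₂ n₂ (φ v) ≐ In m₁ n₁ v ∘ ψ
    In-φ v = (λ {w} a → arc← (subst (λ z → Arc m₂ n₂ z (φ v)) (sym (φ∘ψ w)) a))
           , (λ {w} a → subst (λ z → Arc m₂ n₂ z (φ v)) (φ∘ψ w) (arc→ a))

    Twins-φ : ∀ {u w} → Twins m₁ n₁ u w → Twins m₂ n₂ (φ u) (φ w)
    Twins-φ {u} {w} u≐w = ≐-trans (Out-φ u) (≐-trans (≐-∘ ψ u≐w) (≐-sym (Out-φ w)))

    OutIsIn-φ : ∀ {u} → OutIsIn m₁ n₁ u → OutIsIn m₂ n₂ (φ u)
    OutIsIn-φ {u} (v , u≐v) = φ v , ≐-trans (Out-φ u) (≐-trans (≐-∘ ψ u≐v) (≐-sym (In-φ v)))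

    TwoCycle-φ : ∀ {u v} → TwoCycle m₁ n₁ u v → TwoCycle m₂ n₂ (φ u) (φ v)
    TwoCycle-φ (u→v , v→u) = arc→ u→v , arc→ v→u

    LoopSuccessor-φ : ∀ {u v} → LoopSuccessor m₁ n₁ u v → LoopSuccessor m₂ n₂ (φ u) (φ v)
    LoopSuccessor-φ (u→v , v→v) = arc→ u→v , arc→ v→v

  -- (i): out-twins

  arc-from : ∀ m n {x₁ x₂} y₁ → Arc m n (x₁ , x₂) (y₁ , x₁ ^ᶠ m * y₁ ^ᶠ n + - x₂)
  arc-from m n {x₁} {x₂} y₁ = x+[y-x]≡y x₂ _

  Twins⁻ : ∀ m n {x₁ x₂ w₁ w₂} → Twins m (suc n) (x₁ , x₂) (w₁ , w₂) →
           w₁ ^ᶠ m ≡ x₁ ^ᶠ m × w₂ ≡ x₂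
  Twins⁻ m n {x₁} {x₂} {w₁} {w₂} (u⊆w , _) = w₁^m≡x₁^m , w₂≡x₂
    where
    open ≡-Reasoning
    w₂≡x₂ : w₂ ≡ x₂
    w₂≡x₂ = x-y≡0⇒x≡y (trans (u⊆w (trans (-‿inverseʳ x₂) (sym (x*0^[1+n]≡0 _ n)))) (x*0^[1+n]≡0 _ n))
    w₁^m≡x₁^m : w₁ ^ᶠ m ≡ x₁ ^ᶠ m
    w₁^m≡x₁^m = begin
      w₁ ^ᶠ m                              ≡⟨ sym (x*1^n≡x _ (suc n)) ⟩
      w₁ ^ᶠ m * 1# ^ᶠ suc n                ≡⟨ sym (u⊆w (arc-from m (suc n) 1#)) ⟩
      w₂ + (x₁ ^ᶠ m * 1# ^ᶠ suc n + - x₂)  ≡⟨ cong (_+ _) w₂≡x₂ ⟩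
      x₂ + (x₁ ^ᶠ m * 1# ^ᶠ suc n + - x₂)  ≡⟨ arc-from m (suc n) 1# ⟩
      x₁ ^ᶠ m * 1# ^ᶠ suc n                ≡⟨ x*1^n≡x _ (suc n) ⟩
      x₁ ^ᶠ m                              ∎

  Twins⁺ : ∀ m n {x₁ x₂ w₁ w₂} → w₁ ^ᶠ m ≡ x₁ ^ᶠ m → w₂ ≡ x₂ →
           Twins m n (x₁ , x₂) (w₁ , w₂)
  Twins⁺ m n w₁^m≡x₁^m w₂≡x₂ =
      (λ a → trans (cong (_+ _) w₂≡x₂) (trans a (cong (_* _) (sym w₁^m≡x₁^m))))
    , (λ a → trans (cong (_+ _) (sym w₂≡x₂)) (trans a (cong (_* _) w₁^m≡x₁^m)))

  AtMost-twins : ∀ m n {u} → 1 ≤ m → AtMost (gcdN m) (Twins m (suc n) u)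
  AtMost-twins m n {x₁ , x₂} 1≤m = AtMost-⊆ (λ {(w₁ , w₂)} → Twins⁻ m n)
    (AtMost-graph {P = λ y → y ^ᶠ m ≡ x₁ ^ᶠ m} (λ _ → x₂) (AtMost-fiber m 1≤m (x₁ ^ᶠ m)))

  AtLeast-twins : ∀ m n → AtLeast (gcdN m) (Twins m n (1# , 0#))
  AtLeast-twins m n = AtLeast-map (_, 0#) (cong proj₁)
    (λ (_ , t^m≡1) → Twins⁺ m n (trans t^m≡1 (sym (1^ᶠ m))) refl) (AtLeast-roots-of-unity m)

  gcdN-≤-Twins : ∀ {m₁ n₁ m₂ n₂} → ArcIso m₁ n₁ m₂ (suc n₂) → 1 ≤ m₂ → gcdN m₁ ≤ gcdN m₂
  gcdN-≤-Twins {m₁} {n₁} {m₂} {n₂} I 1≤m₂ = AtLeast⇒≤AtMost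
    (AtLeast-map {Q = Twins m₂ (suc n₂) (φ (1# , 0#))} φ φ-injective (Twins-φ I) (AtLeast-twins m₁ n₁))
    (AtMost-twins m₂ n₂ 1≤m₂)
    where open ArcIso I

  -- (iii): 2-cycles

  AtLeast-0∷ : ∀ {k} {P : Carrier → Set} → P 0# → AtLeast k (λ y → y ≢ 0# × P y) → AtLeast (suc k) P
  AtLeast-0∷ P0 (ys , ys! , Pys , k≤∣ys∣) =
    0# ∷ ys , All.map (λ (y≢0 , _) → y≢0 ∘ sym) Pys ∷ ys! , P0 ∷ All.map proj₂ Pys , s≤s k≤∣ys∣

  Balanced : ℕ → ℕ → Carrier → Carrier → Set
  Balanced m n x y = x ^ᶠ m * y ^ᶠ n ≡ y ^ᶠ m * x ^ᶠ n

  -- The balanced y include 0 and x * t for every root of unity t^∣m-n∣ = 1 (and every y if x = 0).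
  AtLeast-balanced : ∀ m n x → AtLeast (suc (gcdN ∣ suc m - suc n ∣)) (Balanced (suc m) (suc n) x)
  AtLeast-balanced m n x with x ≟ 0#
  ... | yes refl = AtLeast-0∷ (0-balanced 0#)
    (AtLeast-⊆ (λ (y≢0 , _) → y≢0 , 0-balanced _) (AtLeast-roots-of-unity ∣ suc m - suc n ∣))
    where
    0-balanced : ∀ y → Balanced (suc m) (suc n) 0# y
    0-balanced y = trans (0^[1+m]*x≡0 m _) (sym (x*0^[1+n]≡0 _ n))
  ... | no x≢0 = AtLeast-0∷ (trans (x*0^[1+n]≡0 _ n) (sym (0^[1+m]*x≡0 m _)))
    (AtLeast-map (x *_) (*-cancelˡ-≢0 x x≢0) (λ (t≢0 , t^d≡1) → *-≢0 x≢0 t≢0 , x*t-balanced t^d≡1)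
      (AtLeast-roots-of-unity ∣ suc m - suc n ∣))
    where
    x*t-balanced : ∀ {t} → t ^ᶠ ∣ suc m - suc n ∣ ≡ 1# → Balanced (suc m) (suc n) x (x * t)
    x*t-balanced {t} t^d≡1 = begin
      x ^ᶠ suc m * (x * t) ^ᶠ suc n           ≡⟨ cong (x ^ᶠ suc m *_) (^ᶠ-distrib-* x t (suc n)) ⟩
      x ^ᶠ suc m * (x ^ᶠ suc n * t ^ᶠ suc n)  ≡⟨ cong (λ z → x ^ᶠ suc m * (x ^ᶠ suc n * z)) (sym t^m≡t^n) ⟩
      x ^ᶠ suc m * (x ^ᶠ suc n * t ^ᶠ suc m)
        ≡⟨ solve 3 (λ a b c → a :* (b :* c) := (a :* c) :* b) refl (x ^ᶠ suc m) (x ^ᶠ suc n) (t ^ᶠ suc m) ⟩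
      x ^ᶠ suc m * t ^ᶠ suc m * x ^ᶠ suc n    ≡⟨ cong (_* x ^ᶠ suc n) (sym (^ᶠ-distrib-* x t (suc m))) ⟩
      (x * t) ^ᶠ suc m * x ^ᶠ suc n           ∎
      where
      open ≡-Reasoning
      t^m≡t^n = x^∣m-n∣≡1⇒x^m≡x^n (suc m) (suc n) t^d≡1

  AtLeast-twoCycles : ∀ m n u → AtLeast (suc (gcdN ∣ suc m - suc n ∣)) (TwoCycle (suc m) (suc n) u)
  AtLeast-twoCycles m n (x₁ , x₂) = AtLeast-map (λ y → y , x₁ ^ᶠ suc m * y ^ᶠ suc n + - x₂) (cong proj₁)
    (λ {y} balanced → arc-from (suc m) (suc n) y , trans ([x-y]+y≡x _ x₂) balanced)
    (AtLeast-balanced m n x₁)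

  AtMost-twoCycles : ∀ m n → AtMost (suc (gcdN ∣ m - n ∣)) (TwoCycle m n (1# , 0#))
  AtMost-twoCycles m n = AtMost-⊆ (λ {(y , y₂)} c → root (y^m≡y^n c) , y₂≡y^n c)
    (AtMost-graph (_^ᶠ n) (Monic-roots (Monic-x* (Monic-^+c (gcdN≢0 ∣ m - n ∣) (- 1#)))))
    where
    y₂≡y^n : ∀ {y y₂} → TwoCycle m n (1# , 0#) (y , y₂) → y₂ ≡ y ^ᶠ n
    y₂≡y^n (u→v , _) = trans (sym (+-identityˡ _)) (trans u→v (1^m*x≡x m _))
    y^m≡y^n : ∀ {y y₂} → TwoCycle m n (1# , 0#) (y , y₂) → y ^ᶠ m ≡ y ^ᶠ n
    y^m≡y^n c@(_ , v→u) = trans (sym (x*1^n≡x _ n)) (trans (sym v→u) (trans (+-identityʳ _) (y₂≡y^n c)))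
    root : ∀ {y} → y ^ᶠ m ≡ y ^ᶠ n → y * (y ^ᶠ gcdN ∣ m - n ∣ + - 1#) ≡ 0#
    root {y} y^m≡y^n with y ≟ 0#
    ... | yes refl = zeroˡ _
    ... | no y≢0   = trans (cong (y *_) (x≡y⇒x-y≡0
      (x^k≡1⇒x^gcdN≡1 ∣ m - n ∣ y≢0 (x^m≡x^n⇒x^∣m-n∣≡1 m n y≢0 y^m≡y^n)))) (zeroʳ y)

  gcdN-∣m-n∣-≤ : ∀ {m₁ n₁ m₂ n₂} → ArcIso (suc m₁) (suc n₁) m₂ n₂ →
                 gcdN ∣ suc m₁ - suc n₁ ∣ ≤ gcdN ∣ m₂ - n₂ ∣
  gcdN-∣m-n∣-≤ {m₁} {n₁} {m₂} {n₂} I = ℕ.≤-pred (AtLeast⇒≤AtMost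
    (AtLeast-map φ φ-injective
      (λ c → subst (λ z → TwoCycle m₂ n₂ z (φ _)) (φ∘ψ _) (TwoCycle-φ I c))
      (AtLeast-twoCycles m₁ n₁ (ψ (1# , 0#))))
    (AtMost-twoCycles m₂ n₂))
    where open ArcIso I

  -- (ii): loops

  OutIsIn-axis : ∀ m n h → OutIsIn (suc m) (suc n) (0# , h)
  OutIsIn-axis m n h = (0# , h) ,
      (λ {(w₁ , w₂)} a → trans (+-comm w₂ h) (trans a (trans (0^[1+m]*x≡0 m _) (sym (x*0^[1+n]≡0 _ n)))))
    , (λ {(w₁ , w₂)} a → trans (+-comm h w₂) (trans a (trans (x*0^[1+n]≡0 _ n) (sym (0^[1+m]*x≡0 m _)))))

  -- If x₁ ≢ 0, every nonzero t would satisfy t^∣m-n∣ = 1: too many roots.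
  OutIsIn⇒≡0 : ∀ m n → suc m ≢ suc n → ∣ suc m - suc n ∣ < N →
               ∀ {u} → OutIsIn (suc m) (suc n) u → proj₁ u ≡ 0#
  OutIsIn⇒≡0 m n m≢n d<N {x₁ , x₂} ((v₁ , v₂) , out⊆in , _) with x₁ ≟ 0#
  ... | yes x₁≡0 = x₁≡0
  ... | no x₁≢0  = ⊥-elim (ℕ.<⇒≱ d<N (subst (_≤ _) length-nonzeros
    (Monic-roots (Monic-^+c d≢0 (- 1#)) nonzeros nonzeros-unique
      (All.map (λ t≢0 → x≡y⇒x-y≡0 (x^m≡x^n⇒x^∣m-n∣≡1 m′ n′ t≢0 (sym (t^n≡t^m t≢0)))) nonzeros-≢0))))
    where
    m′ = suc m
    n′ = suc n
    d≢0 : ∣ m′ - n′ ∣ ≢ 0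
    d≢0 = m≢n ∘ ℕ.∣m-n∣≡0⇒m≡n
    v₂≡x₂ : v₂ ≡ x₂
    v₂≡x₂ = trans (+-inverseʳ-unique (- x₂) v₂ (trans (out⊆in u→[0,-x₂]) (0^[1+m]*x≡0 m _))) (-‿involutive x₂)
      where u→[0,-x₂] = trans (-‿inverseʳ x₂) (sym (x*0^[1+n]≡0 _ n))
    arc-to-v : ∀ t → x₁ ^ᶠ m′ * t ^ᶠ n′ ≡ t ^ᶠ m′ * v₁ ^ᶠ n′
    arc-to-v t = trans (sym ([x-y]+y≡x _ x₂))
      (trans (cong (x₁ ^ᶠ m′ * t ^ᶠ n′ + - x₂ +_) (sym v₂≡x₂)) (out⊆in (arc-from m′ n′ t)))
    v₁^n≡x₁^m : v₁ ^ᶠ n′ ≡ x₁ ^ᶠ m′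
    v₁^n≡x₁^m = trans (sym (1^m*x≡x m′ _)) (trans (sym (arc-to-v 1#)) (x*1^n≡x _ n′))
    t^n≡t^m : ∀ {t} → t ≢ 0# → t ^ᶠ n′ ≡ t ^ᶠ m′
    t^n≡t^m {t} _ = *-cancelˡ-≢0 (x₁ ^ᶠ m′) (^ᶠ-≢0 m′ x₁≢0)
      (trans (arc-to-v t) (trans (cong (t ^ᶠ m′ *_) v₁^n≡x₁^m) (*-comm _ _)))

  AtMost-loopSuccessors : ∀ m n {u} → proj₁ u ≡ 0# → AtMost (gcdN (suc m ℕ.+ n)) (LoopSuccessor (suc m) n u)
  AtMost-loopSuccessors m n {_ , x₂} refl = AtMost-⊆ (λ {(y , y₂)} s → y^[m+n]≡-2x₂ s , y₂≡-x₂ s)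
    (AtMost-graph {P = λ y → y ^ᶠ (suc m ℕ.+ n) ≡ - x₂ + - x₂} (λ _ → - x₂)
      (AtMost-fiber (suc m ℕ.+ n) (s≤s z≤n) (- x₂ + - x₂)))
    where
    y₂≡-x₂ : ∀ {y y₂} → LoopSuccessor (suc m) n (0# , x₂) (y , y₂) → y₂ ≡ - x₂
    y₂≡-x₂ (u→v , _) = +-inverseʳ-unique x₂ _ (trans u→v (0^[1+m]*x≡0 m _))
    y^[m+n]≡-2x₂ : ∀ {y y₂} → LoopSuccessor (suc m) n (0# , x₂) (y , y₂) →
                   y ^ᶠ (suc m ℕ.+ n) ≡ - x₂ + - x₂
    y^[m+n]≡-2x₂ {y} s@(_ , v→v) =
      trans (^ᶠ-homo-* y (suc m) n) (trans (sym v→v) (cong₂ _+_ (y₂≡-x₂ s) (y₂≡-x₂ s)))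

  AtLeast-loopSuccessors : ¬ 2 ∣ q → ∀ m n →
    ∃[ h ] AtLeast (gcdN (suc m ℕ.+ n)) (LoopSuccessor (suc m) n (0# , h))
  AtLeast-loopSuccessors 2∤q m n = - ½ , AtLeast-map (_, ½) (cong proj₁)
    (λ {t} (_ , t^[m+n]≡1) → trans (-‿inverseˡ ½) (sym (0^[1+m]*x≡0 m _))
                           , trans ½+½≡1 (sym (trans (sym (^ᶠ-homo-* t (suc m) n)) t^[m+n]≡1)))
    (AtLeast-roots-of-unity (suc m ℕ.+ n))
    where
    ½ = inv (1# + 1#) (1+1≢0 2∤q)
    ½+½≡1 : ½ + ½ ≡ 1#
    ½+½≡1 = trans (solve 1 (λ h → h :+ h := (con 1 :+ con 1) :* h) refl ½) (*-inverseʳ _ (1+1≢0 2∤q))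

  gcdN-m+n-≤ : ∀ {m₁ n₁ m₂ n₂} → ¬ 2 ∣ q → ArcIso (suc m₁) (suc n₁) (suc m₂) (suc n₂) →
               suc m₂ ≢ suc n₂ → ∣ suc m₂ - suc n₂ ∣ < N →
               gcdN (suc m₁ ℕ.+ suc n₁) ≤ gcdN (suc m₂ ℕ.+ suc n₂)
  gcdN-m+n-≤ {m₁} {n₁} {m₂} {n₂} 2∤q I m₂≢n₂ d<N = AtLeast⇒≤AtMost images bound
    where
    open ArcIso I
    h = proj₁ (AtLeast-loopSuccessors 2∤q m₁ (suc n₁))
    loops = proj₂ (AtLeast-loopSuccessors 2∤q m₁ (suc n₁))
    images : AtLeast (gcdN (suc m₁ ℕ.+ suc n₁)) (LoopSuccessor (suc m₂) (suc n₂) (φ (0# , h)))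
    images = AtLeast-map φ φ-injective (LoopSuccessor-φ I) loops
    φu-on-axis : proj₁ (φ (0# , h)) ≡ 0#
    φu-on-axis = OutIsIn⇒≡0 m₂ n₂ m₂≢n₂ d<N (OutIsIn-φ I (OutIsIn-axis m₁ n₁ h))
    bound : AtMost (gcdN (suc m₂ ℕ.+ suc n₂)) (LoopSuccessor (suc m₂) (suc n₂) (φ (0# , h)))
    bound = AtMost-loopSuccessors m₂ (suc n₂) φu-on-axis

  gcdN∣n-n∣≡N : ∀ n → gcdN ∣ n - n ∣ ≡ N
  gcdN∣n-n∣≡N n = trans (cong gcdN (ℕ.∣n-n∣≡0 n)) (gcd-identityˡ N)

  gcdN∣m-n∣≡N⇒m≡n : ∀ {m n} → suc m ≤ N → suc n ≤ N →
                    gcdN ∣ suc m - suc n ∣ ≡ N → suc m ≡ suc n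
  gcdN∣m-n∣≡N⇒m≡n m≤N n≤N =
    ℕ.∣m-n∣≡0⇒m≡n ∘ gcd[d,n]≡n⇒d≡0 (∣m-n∣<l (s≤s z≤n) (s≤s z≤n) m≤N n≤N)

  gcdN-m-invariant : ∀ {m₁ n₁ m₂ n₂} → ArcIso (suc m₁) (suc n₁) (suc m₂) (suc n₂) →
                     gcdN (suc m₁) ≡ gcdN (suc m₂)
  gcdN-m-invariant I = ℕ.≤-antisym (gcdN-≤-Twins I (s≤s z≤n)) (gcdN-≤-Twins (ArcIso-sym I) (s≤s z≤n))

  gcdN-∣m-n∣-invariant : ∀ {m₁ n₁ m₂ n₂} → ArcIso (suc m₁) (suc n₁) (suc m₂) (suc n₂) →
                         gcdN ∣ suc m₁ - suc n₁ ∣ ≡ gcdN ∣ suc m₂ - suc n₂ ∣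
  gcdN-∣m-n∣-invariant I = ℕ.≤-antisym (gcdN-∣m-n∣-≤ I) (gcdN-∣m-n∣-≤ (ArcIso-sym I))

  gcdN-m+n-invariant : ∀ {m₁ n₁ m₂ n₂} → ¬ 2 ∣ q →
    suc m₁ ≤ N → suc n₁ ≤ N → suc m₂ ≤ N → suc n₂ ≤ N →
    ArcIso (suc m₁) (suc n₁) (suc m₂) (suc n₂) → gcdN (suc m₁ ℕ.+ suc n₁) ≡ gcdN (suc m₂ ℕ.+ suc n₂)
  gcdN-m+n-invariant {m₁} {n₁} {m₂} {n₂} 2∤q m₁≤N n₁≤N m₂≤N n₂≤N I with suc m₁ ℕ.≟ suc n₁
  ... | yes refl = begin
    gcdN (suc m₁ ℕ.+ suc m₁)               ≡⟨ gcd[m+m,n]≡gcd[2*gcd[m,n],n] (suc m₁) N ⟩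
    gcd (2 ℕ.* gcdN (suc m₁)) N            ≡⟨ cong (λ g → gcd (2 ℕ.* g) N) (gcdN-m-invariant I) ⟩
    gcd (2 ℕ.* gcdN (suc m₂)) N            ≡⟨ sym (gcd[m+m,n]≡gcd[2*gcd[m,n],n] (suc m₂) N) ⟩
    gcdN (suc m₂ ℕ.+ suc m₂)               ≡⟨ cong (λ k → gcdN (suc m₂ ℕ.+ k)) m₂≡n₂ ⟩
    gcdN (suc m₂ ℕ.+ suc n₂)               ∎
    where
    open ≡-Reasoning
    m₂≡n₂ : suc m₂ ≡ suc n₂
    m₂≡n₂ = gcdN∣m-n∣≡N⇒m≡n m₂≤N n₂≤N
      (trans (sym (gcdN-∣m-n∣-invariant I)) (gcdN∣n-n∣≡N (suc m₁)))
  ... | no m₁≢n₁ = ℕ.≤-antisym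
    (gcdN-m+n-≤ 2∤q I m₂≢n₂ (∣m-n∣<l (s≤s z≤n) (s≤s z≤n) m₂≤N n₂≤N))
    (gcdN-m+n-≤ 2∤q (ArcIso-sym I) m₁≢n₁ (∣m-n∣<l (s≤s z≤n) (s≤s z≤n) m₁≤N n₁≤N))
    where
    m₂≢n₂ : suc m₂ ≢ suc n₂
    m₂≢n₂ refl = m₁≢n₁ (gcdN∣m-n∣≡N⇒m≡n m₁≤N n₁≤N
      (trans (gcdN-∣m-n∣-invariant I) (gcdN∣n-n∣≡N (suc m₂))))

  conditions : ∀ {m₁ n₁ m₂ n₂} → Admissible q m₁ n₁ m₂ n₂ → DigraphIso F m₁ n₁ m₂ n₂ →
               Cond-i q m₁ n₁ m₂ n₂ × Cond-ii q m₁ n₁ m₂ n₂ × Cond-iii q m₁ n₁ m₂ n₂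
  conditions {suc m₁} {suc n₁} {suc m₂} {suc n₂}
    ((_ , 2∤q) , (_ , m₁≤N) , (_ , n₁≤N) , (_ , m₂≤N) , (_ , n₂≤N)) D =
      (cong ℤ.+_ (gcdN-m-invariant I) , cong ℤ.+_ (gcdN-m-invariant (ArcIso-reverse I)))
    , cong ℤ.+_ (gcdN-m+n-invariant 2∤q m₁≤N n₁≤N m₂≤N n₂≤N I)
    , trans (gcdQ-∣m-n∣ q (suc m₁) (suc n₁))
        (trans (cong ℤ.+_ (gcdN-∣m-n∣-invariant I)) (sym (gcdQ-∣m-n∣ q (suc m₂) (suc n₂))))
    where I = toArcIso D

OddPrimePower-11 : OddPrimePower 11
OddPrimePower-11 = (11 , 1 , toWitness {a? = prime? 11} _ , s≤s z≤n , refl) , toWitnessFalse {a? = 2 ∣? 11} _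

InRange-11 : ∀ {m} {1≤m : True (1 ≤? m)} {m≤10 : True (m ≤? 10)} → InRange 11 m
InRange-11 {1≤m = 1≤m} {m≤10} = toWitness 1≤m , toWitness m≤10

theorem8 :
    (∀ q (F : FiniteField q) m₁ n₁ m₂ n₂ →
       Admissible q m₁ n₁ m₂ n₂ → DigraphIso F m₁ n₁ m₂ n₂ →
       Cond-i q m₁ n₁ m₂ n₂ × Cond-ii q m₁ n₁ m₂ n₂ × Cond-iii q m₁ n₁ m₂ n₂)
    ×
    (∃ λ q → ∃ λ m₁ → ∃ λ n₁ → ∃ λ m₂ → ∃ λ n₂ → Admissible q m₁ n₁ m₂ n₂ ×
       ¬ Cond-i q m₁ n₁ m₂ n₂ × Cond-ii q m₁ n₁ m₂ n₂ × Cond-iii q m₁ n₁ m₂ n₂)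
    ×
    (∃ λ q → ∃ λ m₁ → ∃ λ n₁ → ∃ λ m₂ → ∃ λ n₂ → Admissible q m₁ n₁ m₂ n₂ ×
       Cond-i q m₁ n₁ m₂ n₂ × ¬ Cond-ii q m₁ n₁ m₂ n₂ × Cond-iii q m₁ n₁ m₂ n₂)
    ×
    (∃ λ q → ∃ λ m₁ → ∃ λ n₁ → ∃ λ m₂ → ∃ λ n₂ → Admissible q m₁ n₁ m₂ n₂ ×
       Cond-i q m₁ n₁ m₂ n₂ × Cond-ii q m₁ n₁ m₂ n₂ × ¬ Cond-iii q m₁ n₁ m₂ n₂)
theorem8 =
    (λ q F m₁ n₁ m₂ n₂ → conditions F)
  , (11 , 1 , 1 , 2 , 2 , (OddPrimePower-11 , InRange-11 , InRange-11 , InRange-11 , InRange-11) ,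
     (λ { (() , _) }) , refl , refl)
  , (11 , 1 , 2 , 1 , 4 , (OddPrimePower-11 , InRange-11 , InRange-11 , InRange-11 , InRange-11) ,
     (refl , refl) , (λ ()) , refl)
  , (11 , 1 , 1 , 1 , 3 , (OddPrimePower-11 , InRange-11 , InRange-11 , InRange-11 , InRange-11) ,
     (refl , refl) , refl , (λ ()))
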